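{- Let $A$ be computably traceable, and let $B$ be computably traceable relative to $A$. Then $B$ is computably traceable.
   Context: A trace is a set $T\subseteq\omega\times\omega$ all of whose sections $T^{[k]}=\{n\mid (k,n)\in T\}$ are finite; it is computable (resp. $A$-computable) if the map sending $k$ to the canonical index of the finite set $T^{[k]}$ is computable (resp. computable in $A$). $T$ traces $g$ if $g(k)\in T^{[k]}$ for all $k$. A bound is a non-decreasing function $h:\omega\to\omega$ with infinite range; $T$ is bounded by $h$ if $|T^{[k]}|\le h(k)$ for all $k$. A function (or set) $f$ is computably traceable if there is a computable bound $h$ such that every total function $g\le_T f$ is traced by a computable trace bounded by $h$. $B$ is computably traceable relative to $A$ if there is an $A$-computable bound $h$ such that every total function $g\le_T B$ is traced by an $A$-computable trace bounded by $h$. -}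

module Defs where

open import Data.Nat using (ℕ; zero; suc; _+_; _≤_; _<_)
open import Data.Nat.DivMod using (_/_; _%_)
open import Data.Fin using (Fin)
open import Data.Vec using (Vec; []; _∷_; lookup)
open import Data.Bool using (Bool; true; false)
open import Data.Product using (Σ; _×_; ∃)
open import Relation.Binary.PropositionalEquality using (_≡_)

-- Oracle (relativised) partial recursive functions (Kleene μ-recursion
-- with an extra oracle-query basic function).

data Code : ℕ → Set where
  zer  : ∀ {n} → Code n
  sucᶜ : Code 1
  prj  : ∀ {n} → Fin n → Code n
  orc  : Code 1
  comp : ∀ {m n} → Code m → Vec (Code n) m → Code n
  prec : ∀ {n} → Code n → Code (suc (suc n)) → Code (suc n)
  mu   : ∀ {n} → Code (suc n) → Code n

-- Big-step semantics relative to the oracle O : ℕ → ℕ.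
-- Eval O c xs y  means  Φ_c^O(xs) converges with value y.
mutual
  data Eval (O : ℕ → ℕ) : ∀ {n} → Code n → Vec ℕ n → ℕ → Set where
    ezer  : ∀ {n} {xs : Vec ℕ n} → Eval O zer xs 0
    esuc  : ∀ {x} → Eval O sucᶜ (x ∷ []) (suc x)
    eprj  : ∀ {n} {xs : Vec ℕ n} (i : Fin n) → Eval O (prj i) xs (lookup xs i)
    eorc  : ∀ {x} → Eval O orc (x ∷ []) (O x)
    ecomp : ∀ {m n} {f : Code m} {gs : Vec (Code n) m} {xs ys z} →
            EvalAll O gs xs ys → Eval O f ys z → Eval O (comp f gs) xs z
    eprec0 : ∀ {n} {f : Code n} {g xs z} →
             Eval O f xs z → Eval O (prec f g) (0 ∷ xs) z
    eprecS : ∀ {n} {f : Code n} {g xs y z w} →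
             Eval O (prec f g) (y ∷ xs) z → Eval O g (y ∷ z ∷ xs) w →
             Eval O (prec f g) (suc y ∷ xs) w
    emu   : ∀ {n} {f : Code (suc n)} {xs y} →
            Eval O f (y ∷ xs) 0 →
            (∀ i → i < y → Σ ℕ (λ v → Eval O f (i ∷ xs) (suc v))) →
            Eval O (mu f) xs y

  data EvalAll (O : ℕ → ℕ) : ∀ {m n} → Vec (Code n) m → Vec ℕ n → Vec ℕ m → Set where
    [] : ∀ {n} {xs : Vec ℕ n} → EvalAll O [] xs []
    _∷_ : ∀ {m n} {g : Code n} {gs : Vec (Code n) m} {xs y ys} →
          Eval O g xs y → EvalAll O gs xs ys → EvalAll O (g ∷ gs) xs (y ∷ ys)

Computes : (O : ℕ → ℕ) → Code 1 → (ℕ → ℕ) → Set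
Computes O c f = ∀ x → Eval O c (x ∷ []) (f x)

_≤T_ : (ℕ → ℕ) → (ℕ → ℕ) → Set
f ≤T O = Σ (Code 1) (λ c → Computes O c f)

χ : (ℕ → Bool) → ℕ → ℕ
χ A n with A n
... | true  = 1
... | false = 0

∅ : ℕ → ℕ
∅ _ = 0

Computable : (ℕ → ℕ) → Set
Computable f = f ≤T ∅

-- Canonical indices of finite sets: D_n = { i | bit i of n is 1 }.

bit : ℕ → ℕ → ℕ
bit n zero    = n % 2
bit n (suc i) = bit (n / 2) i

_∈D_ : ℕ → ℕ → Set
i ∈D n = bit n i ≡ 1

sumBelow : (ℕ → ℕ) → ℕ → ℕ
sumBelow f zero    = 0
sumBelow f (suc k) = sumBelow f k + f k

-- |D_n| (all elements of D_n are < n, since n < 2^n)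
cardD : ℕ → ℕ
cardD n = sumBelow (bit n) n

-- Traces.  A trace T is represented by the map t : k ↦ canonical index
-- of T^[k]; it is O-computable iff t ≤T O.

Traces : (ℕ → ℕ) → (ℕ → ℕ) → Set
Traces t g = ∀ k → g k ∈D t k

BoundedBy : (ℕ → ℕ) → (ℕ → ℕ) → Set
BoundedBy t h = ∀ k → cardD (t k) ≤ h k

IsBound : (ℕ → ℕ) → Set
IsBound h = (∀ m n → m ≤ n → h m ≤ h n) × (∀ N → ∃ (λ k → N ≤ h k))

CompTraceable : (ℕ → ℕ) → Set
CompTraceable f =
  Σ (ℕ → ℕ) (λ h → Computable h × IsBound h ×
    (∀ g → g ≤T f → Σ (ℕ → ℕ) (λ t → Computable t × Traces t g × BoundedBy t h)))

CompTraceableRel : (ℕ → ℕ) → (ℕ → ℕ) → Set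
CompTraceableRel b a =
  Σ (ℕ → ℕ) (λ h → h ≤T a × IsBound h ×
    (∀ g → g ≤T b → Σ (ℕ → ℕ) (λ t → t ≤T a × Traces t g × BoundedBy t h)))

-- As A is computably traceable, every A-computable function f is dominated by a computable one:
-- take a computable trace T of f; every element of D n is below n, so f k < T 0 + ⋯ + T k.
-- Apply this to the A-computable bound hB, getting a computable monotone M > hB. Given g ≤T B,
-- take its A-computable trace t (bounded by hB) and a computable trace S of t (bounded by hA).
-- Since D (t k) has at most hB k < M k elements, it is one of the sets D n with n ∈ D (S k) and
-- |D n| ≤ M k, so their union is a computable trace of g with at most hA k · M k elements per
-- section. Thus (1 + hA) · M is a computable bound that works.

module Submission where

open import Defs
open import Data.Bool using (Bool)
open import Data.Fin using (zero; suc)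
open import Data.List using (foldr; downFrom)
open import Data.Nat using (ℕ; zero; suc; _+_; _*_; _∸_; _^_; pred; _≤_; _<_; z≤n; s≤s; s≤s⁻¹)
open import Data.Nat.DivMod
open import Data.Nat.Divisibility using (m∣m*n)
open import Data.Nat.GeneralisedArithmetic using (fold; iterate; iterate-is-fold)
open import Data.Nat.Properties
open import Data.Product using (Σ; _,_; _×_)
open import Data.Sum using (inj₁; inj₂)
open import Data.Vec using (Vec; []; _∷_; lookup)
open import Relation.Binary.PropositionalEquality
open import Relation.Nullary using (yes; no; contradiction)

Computableⁿ : (n : ℕ) → (Vec ℕ n → ℕ) → Set
Computableⁿ n f = Σ (Code n) λ c → ∀ xs → Eval ∅ c xs (f xs)

AllComputable : (n m : ℕ) → (Vec ℕ n → Vec ℕ m) → Set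
AllComputable n m fs = Σ (Vec (Code n) m) λ cs → ∀ xs → EvalAll ∅ cs xs (fs xs)

[]ᶜ : ∀ {n} → AllComputable n 0 (λ _ → [])
[]ᶜ = [] , λ _ → []

infixr 5 _∷ᶜ_
_∷ᶜ_ : ∀ {n m f fs} → Computableⁿ n f → AllComputable n m fs →
       AllComputable n (suc m) (λ xs → f xs ∷ fs xs)
(c , ev) ∷ᶜ (cs , evs) = c ∷ cs , λ xs → ev xs ∷ evs xs

infix 4 _∘ᶜ_
_∘ᶜ_ : ∀ {n m g fs} → Computableⁿ m g → AllComputable n m fs → Computableⁿ n (λ xs → g (fs xs))
_∘ᶜ_ {fs = fs} (c , ev) (cs , evs) = comp c cs , λ xs → ecomp (evs xs) (ev (fs xs))

computable-≗ : ∀ {n f g} → Computableⁿ n f → f ≗ g → Computableⁿ n g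
computable-≗ (c , ev) f≗g = c , λ xs → subst (Eval ∅ c xs) (f≗g xs) (ev xs)

prec-computable : ∀ {n f g} (F : Vec ℕ (suc n) → ℕ) →
  Computableⁿ n f → Computableⁿ (suc (suc n)) g →
  (∀ xs → f xs ≡ F (0 ∷ xs)) → (∀ y xs → g (y ∷ F (y ∷ xs) ∷ xs) ≡ F (suc y ∷ xs)) →
  Computableⁿ (suc n) F
prec-computable F (cf , evf) (cg , evg) base step = prec cf cg , ev
  where
  ev : ∀ xs → Eval ∅ (prec cf cg) xs (F xs)
  ev (zero  ∷ xs) = subst (Eval ∅ _ _) (base xs) (eprec0 (evf xs))
  ev (suc y ∷ xs) = subst (Eval ∅ _ _) (step y xs) (eprecS (ev (y ∷ xs)) (evg _))

π₀ : ∀ {n} → Computableⁿ (suc n) (λ xs → lookup xs zero)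
π₀ = prj zero , λ _ → eprj zero

π₁ : ∀ {n} → Computableⁿ (suc (suc n)) (λ xs → lookup xs (suc zero))
π₁ = prj (suc zero) , λ _ → eprj (suc zero)

π₂ : ∀ {n} → Computableⁿ (suc (suc (suc n))) (λ xs → lookup xs (suc (suc zero)))
π₂ = prj (suc (suc zero)) , λ _ → eprj (suc (suc zero))

π₃ : ∀ {n} → Computableⁿ (suc (suc (suc (suc n)))) (λ xs → lookup xs (suc (suc (suc zero))))
π₃ = prj (suc (suc (suc zero))) , λ _ → eprj (suc (suc (suc zero)))

uncurry₁ : (ℕ → ℕ) → Vec ℕ 1 → ℕ
uncurry₁ f xs = f (lookup xs zero)

uncurry₂ : (ℕ → ℕ → ℕ) → Vec ℕ 2 → ℕ
uncurry₂ f xs = f (lookup xs zero) (lookup xs (suc zero))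

uncurry₃ : (ℕ → ℕ → ℕ → ℕ) → Vec ℕ 3 → ℕ
uncurry₃ f xs = f (lookup xs zero) (lookup xs (suc zero)) (lookup xs (suc (suc zero)))

computable⇒computableⁿ : ∀ {f} → Computable f → Computableⁿ 1 (uncurry₁ f)
computable⇒computableⁿ (c , ev) = c , λ { (x ∷ []) → ev x }

computableⁿ⇒computable : ∀ {f} → Computableⁿ 1 (uncurry₁ f) → Computable f
computableⁿ⇒computable (c , ev) = c , λ x → ev (x ∷ [])

suc-computable : Computableⁿ 1 (uncurry₁ suc)
suc-computable = sucᶜ , λ { (x ∷ []) → esuc }

const-computable : ∀ {n} k → Computableⁿ n (λ _ → k)
const-computable zero    = zer , λ _ → ezer
const-computable (suc k) = suc-computable ∘ᶜ const-computable k ∷ᶜ []ᶜ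

+-computable : Computableⁿ 2 (uncurry₂ _+_)
+-computable = prec-computable _ π₀ (suc-computable ∘ᶜ π₁ ∷ᶜ []ᶜ) (λ _ → refl) (λ _ _ → refl)

*-computable : Computableⁿ 2 (uncurry₂ _*_)
*-computable = prec-computable _ (const-computable 0) (+-computable ∘ᶜ π₂ ∷ᶜ π₁ ∷ᶜ []ᶜ)
  (λ _ → refl) (λ _ _ → refl)

∸-computable : Computableⁿ 2 (uncurry₂ _∸_)
∸-computable = computable-≗ (flipped ∘ᶜ π₁ ∷ᶜ π₀ ∷ᶜ []ᶜ) (λ _ → refl)
  where
  pred-computable : Computableⁿ 1 (uncurry₁ pred)
  pred-computable = prec-computable _ (const-computable 0) π₀ (λ _ → refl) (λ _ _ → refl)

  flipped : Computableⁿ 2 (uncurry₂ λ n m → m ∸ n)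
  flipped = prec-computable _ π₀ (pred-computable ∘ᶜ π₁ ∷ᶜ []ᶜ)
    (λ _ → refl) (λ n xs → pred[m∸n]≡m∸[1+n] (lookup xs zero) n)

ifz : ℕ → ℕ → ℕ → ℕ
ifz zero    a b = a
ifz (suc _) a b = b

ifz-computable : Computableⁿ 3 (uncurry₃ ifz)
ifz-computable = prec-computable _ π₀ π₃ (λ _ → refl) (λ _ _ → refl)

2^-computable : Computableⁿ 1 (uncurry₁ (2 ^_))
2^-computable = prec-computable _ (const-computable 1) (*-computable ∘ᶜ const-computable 2 ∷ᶜ π₁ ∷ᶜ []ᶜ)
  (λ _ → refl) (λ _ _ → refl)

sumBelow-computable : ∀ {f} → Computableⁿ 2 (uncurry₂ f) →
  Computableⁿ 2 (uncurry₂ λ j p → sumBelow (λ i → f i p) j)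
sumBelow-computable f-computable = prec-computable _ (const-computable 0)
  (+-computable ∘ᶜ π₁ ∷ᶜ (f-computable ∘ᶜ π₀ ∷ᶜ π₂ ∷ᶜ []ᶜ) ∷ᶜ []ᶜ) (λ _ → refl) (λ _ _ → refl)

[2+n]%2≡n%2 : ∀ n → suc (suc n) % 2 ≡ n % 2
[2+n]%2≡n%2 n = trans (cong (_% 2) (+-comm 2 n)) ([m+n]%n≡m%n n 2)

[2+n]/2≡1+n/2 : ∀ n → suc (suc n) / 2 ≡ suc (n / 2)
[2+n]/2≡1+n/2 n = m/n≡1+[m∸n]/n {suc (suc n)} (s≤s (s≤s z≤n))

[1+n]%2≡1∸n%2 : ∀ n → suc n % 2 ≡ 1 ∸ n % 2
[1+n]%2≡1∸n%2 zero          = refl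
[1+n]%2≡1∸n%2 (suc zero)    = refl
[1+n]%2≡1∸n%2 (suc (suc n)) = begin
  suc (suc (suc n)) % 2 ≡⟨ [2+n]%2≡n%2 (suc n) ⟩
  suc n % 2             ≡⟨ [1+n]%2≡1∸n%2 n ⟩
  1 ∸ n % 2             ≡⟨ cong (1 ∸_) ([2+n]%2≡n%2 n) ⟨
  1 ∸ suc (suc n) % 2   ∎
  where open ≡-Reasoning

[1+n]/2≡n/2+n%2 : ∀ n → suc n / 2 ≡ n / 2 + n % 2
[1+n]/2≡n/2+n%2 zero          = refl
[1+n]/2≡n/2+n%2 (suc zero)    = refl
[1+n]/2≡n/2+n%2 (suc (suc n)) = begin
  suc (suc (suc n)) / 2         ≡⟨ [2+n]/2≡1+n/2 (suc n) ⟩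
  suc (suc n / 2)               ≡⟨ cong suc ([1+n]/2≡n/2+n%2 n) ⟩
  suc (n / 2 + n % 2)           ≡⟨ cong₂ _+_ ([2+n]/2≡1+n/2 n) ([2+n]%2≡n%2 n) ⟨
  suc (suc n) / 2 + suc (suc n) % 2 ∎
  where open ≡-Reasoning

%2-computable : Computableⁿ 1 (uncurry₁ (_% 2))
%2-computable = prec-computable _ (const-computable 0) (∸-computable ∘ᶜ const-computable 1 ∷ᶜ π₁ ∷ᶜ []ᶜ)
  (λ _ → refl) (λ n _ → sym ([1+n]%2≡1∸n%2 n))

/2-computable : Computableⁿ 1 (uncurry₁ (_/ 2))
/2-computable = prec-computable _ (const-computable 0)
  (+-computable ∘ᶜ π₁ ∷ᶜ (%2-computable ∘ᶜ π₀ ∷ᶜ []ᶜ) ∷ᶜ []ᶜ)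
  (λ _ → refl) (λ n _ → sym ([1+n]/2≡n/2+n%2 n))

-- `bit` recurses on the position with a changing number, which is not the shape of primitive
-- recursion; `fold n (_/ 2) i` is.
bit≡fold : ∀ n i → bit n i ≡ fold n (_/ 2) i % 2
bit≡fold n i = trans (bit≡iterate n i) (cong (_% 2) (sym (iterate-is-fold n (_/ 2) i)))
  where
  bit≡iterate : ∀ n i → bit n i ≡ iterate (_/ 2) n i % 2
  bit≡iterate n zero    = refl
  bit≡iterate n (suc i) = bit≡iterate (n / 2) i

bit-computable : Computableⁿ 2 (uncurry₂ bit)
bit-computable = computable-≗ (%2-computable ∘ᶜ (halvings ∘ᶜ π₁ ∷ᶜ π₀ ∷ᶜ []ᶜ) ∷ᶜ []ᶜ)
  (λ xs → sym (bit≡fold (lookup xs zero) (lookup xs (suc zero))))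
  where
  halvings : Computableⁿ 2 (uncurry₂ λ i n → fold n (_/ 2) i)
  halvings = prec-computable _ π₀ (/2-computable ∘ᶜ π₁ ∷ᶜ []ᶜ) (λ _ → refl) (λ _ _ → refl)

cardD-computable : Computableⁿ 1 (uncurry₁ cardD)
cardD-computable = sumBelow-computable {λ i n → bit n i} (bit-computable ∘ᶜ π₁ ∷ᶜ π₀ ∷ᶜ []ᶜ)
  ∘ᶜ π₀ ∷ᶜ π₀ ∷ᶜ []ᶜ

bit<2 : ∀ n i → bit n i < 2
bit<2 n zero    = m%n<n n 2
bit<2 n (suc i) = bit<2 (n / 2) i

∈D⇒< : ∀ {i n} → i ∈D n → i < n
∈D⇒< {zero}  {zero}  ()
∈D⇒< {zero}  {suc n} _    = s≤s z≤n
∈D⇒< {suc i} {n}     i∈n = begin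
  suc (suc i) ≤⟨ s≤s (s≤s (m≤m*n i 2)) ⟩
  suc i * 2   ≤⟨ *-monoˡ-≤ 2 (∈D⇒< {i} {n / 2} i∈n) ⟩
  n / 2 * 2   ≤⟨ m/n*n≤m n 2 ⟩
  n           ∎
  where open ≤-Reasoning

∉D-≥ : ∀ {n i} → n ≤ i → bit n i ≡ 0
∉D-≥ {n} {i} n≤i with bit n i in eq | bit<2 n i
... | zero        | _ = refl
... | suc zero    | _ = contradiction n≤i (<⇒≱ (∈D⇒< eq))
... | suc (suc _) | s≤s (s≤s ())

sumBelow-mono : ∀ f {m n} → m ≤ n → sumBelow f m ≤ sumBelow f n
sumBelow-mono f {n = zero}  z≤n   = ≤-refl
sumBelow-mono f {n = suc n} m≤1+n with m≤n⇒m<n∨m≡n m≤1+n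
... | inj₁ m<1+n = ≤-trans (sumBelow-mono f (s≤s⁻¹ m<1+n)) (m≤m+n _ (f n))
... | inj₂ refl  = ≤-refl

sumBelow-beyond : ∀ f {n N} → (∀ i → n ≤ i → f i ≡ 0) → n ≤ N → sumBelow f N ≡ sumBelow f n
sumBelow-beyond f {N = zero}  _      z≤n   = refl
sumBelow-beyond f {N = suc N} vanish n≤1+N with m≤n⇒m<n∨m≡n n≤1+N
... | inj₁ n<1+N = let n≤N = s≤s⁻¹ n<1+N in
  trans (cong₂ _+_ (sumBelow-beyond f vanish n≤N) (vanish N n≤N)) (+-identityʳ _)
... | inj₂ refl  = refl

sumBelow-*ʳ : ∀ f c j → sumBelow (λ i → f i * c) j ≡ sumBelow f j * c
sumBelow-*ʳ f c zero    = refl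
sumBelow-*ʳ f c (suc j) =
  trans (cong (_+ f j * c) (sumBelow-*ʳ f c j)) (sym (*-distribʳ-+ c (sumBelow f j) (f j)))

sumBelow-≤ : ∀ {f g} N → (∀ i → i < N → f i ≤ g i) → sumBelow f N ≤ sumBelow g N
sumBelow-≤ zero    f≤g = z≤n
sumBelow-≤ (suc N) f≤g = +-mono-≤ (sumBelow-≤ N λ i i<N → f≤g i (m<n⇒m<1+n i<N)) (f≤g N ≤-refl)

sumBelow-≤-except : ∀ {f g} x N → (∀ i → i ≢ x → f i ≤ g i) → f x ≤ suc (g x) →
  sumBelow f N ≤ suc (sumBelow g N)
sumBelow-≤-except x zero    f≤g fx≤1+gx = z≤n
sumBelow-≤-except x (suc N) f≤g fx≤1+gx with N ≟ x
... | yes refl = ≤-trans (+-mono-≤ (sumBelow-≤ N λ i i<N → f≤g i (<⇒≢ i<N)) fx≤1+gx)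
                         (≤-reflexive (+-suc _ _))
... | no N≢x   = +-mono-≤ (sumBelow-≤-except x N f≤g fx≤1+gx) (f≤g N N≢x)

cardD-≥ : ∀ {n N} → n ≤ N → sumBelow (bit n) N ≡ cardD n
cardD-≥ {n} = sumBelow-beyond (bit n) (λ _ → ∉D-≥)

[s+2p]%2≡s%2 : ∀ s p → (s + 2 * p) % 2 ≡ s % 2
[s+2p]%2≡s%2 s p = %-remove-+ʳ s (m∣m*n p)

[s+2p]/2≡s/2+p : ∀ s p → (s + 2 * p) / 2 ≡ s / 2 + p
[s+2p]/2≡s/2+p s p = trans (+-distrib-/-∣ʳ s (m∣m*n p))
  (cong (s / 2 +_) (trans (cong (_/ 2) (*-comm 2 p)) (m*n/n≡m p 2)))

even⇒[s+1]%2≡1 : ∀ s → s % 2 ≡ 0 → (s + 1) % 2 ≡ 1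
even⇒[s+1]%2≡1 s s-even = trans (%-distribˡ-+ s 1 2) (cong (λ r → (r + 1) % 2) s-even)

even⇒[s+1]/2≡s/2 : ∀ s → s % 2 ≡ 0 → (s + 1) / 2 ≡ s / 2
even⇒[s+1]/2≡s/2 s s-even =
  trans (+-distrib-/ s 1 (subst (λ r → r + 1 % 2 < 2) (sym s-even) (s≤s (s≤s z≤n)))) (+-identityʳ _)

bit-+2^-≡ : ∀ x s → bit s x ≡ 0 → bit (s + 2 ^ x) x ≡ 1
bit-+2^-≡ zero    s x∉s = even⇒[s+1]%2≡1 s x∉s
bit-+2^-≡ (suc x) s x∉s =
  trans (cong (λ r → bit r x) ([s+2p]/2≡s/2+p s (2 ^ x))) (bit-+2^-≡ x (s / 2) x∉s)

bit-+2^-≢ : ∀ x s {y} → bit s x ≡ 0 → y ≢ x → bit (s + 2 ^ x) y ≡ bit s y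
bit-+2^-≢ zero    s {zero}  x∉s y≢x = contradiction refl y≢x
bit-+2^-≢ zero    s {suc y} x∉s y≢x = cong (λ r → bit r y) (even⇒[s+1]/2≡s/2 s x∉s)
bit-+2^-≢ (suc x) s {zero}  x∉s y≢x = [s+2p]%2≡s%2 s (2 ^ x)
bit-+2^-≢ (suc x) s {suc y} x∉s y≢x = trans (cong (λ r → bit r y) ([s+2p]/2≡s/2+p s (2 ^ x)))
  (bit-+2^-≢ x (s / 2) x∉s (λ y≡x → y≢x (cong suc y≡x)))

insert : ℕ → ℕ → ℕ
insert x s = ifz (bit s x) (s + 2 ^ x) s

insert-computable : Computableⁿ 2 (uncurry₂ insert)
insert-computable = ifz-computable ∘ᶜ (bit-computable ∘ᶜ π₁ ∷ᶜ π₀ ∷ᶜ []ᶜ)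
  ∷ᶜ (+-computable ∘ᶜ π₁ ∷ᶜ (2^-computable ∘ᶜ π₀ ∷ᶜ []ᶜ) ∷ᶜ []ᶜ) ∷ᶜ π₁ ∷ᶜ []ᶜ

∈-insert-self : ∀ x s → x ∈D insert x s
∈-insert-self x s with bit s x in eq | bit<2 s x
... | zero        | _ = bit-+2^-≡ x s eq
... | suc zero    | _ = eq
... | suc (suc _) | s≤s (s≤s ())

bit-insert-≢ : ∀ x s {y} → y ≢ x → bit (insert x s) y ≡ bit s y
bit-insert-≢ x s y≢x with bit s x in eq
... | zero  = bit-+2^-≢ x s eq y≢x
... | suc _ = refl

∈-insert⁺ : ∀ x s y → y ∈D s → y ∈D insert x s
∈-insert⁺ x s y y∈s with y ≟ x
... | yes refl = ∈-insert-self x s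
... | no y≢x   = trans (bit-insert-≢ x s y≢x) y∈s

≤-insert : ∀ x s → s ≤ insert x s
≤-insert x s with bit s x
... | zero  = m≤m+n s (2 ^ x)
... | suc _ = ≤-refl

cardD-insert : ∀ x s → cardD (insert x s) ≤ suc (cardD s)
cardD-insert x s = begin
  sumBelow (bit (insert x s)) (insert x s) ≤⟨ sumBelow-≤-except x (insert x s)
                                               (λ _ y≢x → ≤-reflexive (bit-insert-≢ x s y≢x))
                                               (≤-trans (s≤s⁻¹ (bit<2 (insert x s) x)) (s≤s z≤n)) ⟩
  suc (sumBelow (bit s) (insert x s))      ≡⟨ cong suc (cardD-≥ (≤-insert x s)) ⟩
  suc (cardD s)                            ∎
  where open ≤-Reasoning

module _ {A : Set} {step : ℕ → A → A} where

  foldr-downFrom-preserves : {P : A → Set} → (∀ i r → P r → P (step i r)) →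
    ∀ j {acc} → P acc → P (foldr step acc (downFrom j))
  foldr-downFrom-preserves step-pres zero    p = p
  foldr-downFrom-preserves step-pres (suc j) p = step-pres j _ (foldr-downFrom-preserves step-pres j p)

  foldr-downFrom-establishes : {P : A → Set} → (∀ i r → P r → P (step i r)) →
    ∀ i → (∀ r → P (step i r)) → ∀ j {acc} → i < j → P (foldr step acc (downFrom j))
  foldr-downFrom-establishes step-pres i step-est (suc j) i<1+j with m≤n⇒m<n∨m≡n (s≤s⁻¹ i<1+j)
  ... | inj₁ i<j = step-pres j _ (foldr-downFrom-establishes step-pres i step-est j i<j)
  ... | inj₂ refl = step-est _

  foldr-downFrom-≤ : (size : A → ℕ) (c : ℕ → ℕ) → (∀ i r → size (step i r) ≤ size r + c i) →
    ∀ j acc → size (foldr step acc (downFrom j)) ≤ size acc + sumBelow c j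
  foldr-downFrom-≤ size c step-bound zero    acc = ≤-reflexive (sym (+-identityʳ _))
  foldr-downFrom-≤ size c step-bound (suc j) acc = begin
    size (step j (foldr step acc (downFrom j))) ≤⟨ step-bound j _ ⟩
    size (foldr step acc (downFrom j)) + c j    ≤⟨ +-monoˡ-≤ (c j) (foldr-downFrom-≤ size c step-bound j _) ⟩
    size acc + sumBelow c j + c j               ≡⟨ +-assoc (size acc) _ _ ⟩
    size acc + sumBelow c (suc j)               ∎
    where open ≤-Reasoning

union-step : ℕ → ℕ → ℕ → ℕ
union-step n i r = ifz (bit n i) r (insert i r)

union : ℕ → ℕ → ℕ
union n s = foldr (union-step n) s (downFrom n)

union-computable : Computableⁿ 2 (uncurry₂ union)
union-computable = computable-≗ (unionBelow ∘ᶜ π₀ ∷ᶜ π₀ ∷ᶜ π₁ ∷ᶜ []ᶜ) (λ _ → refl)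
  where
  unionBelow : Computableⁿ 3 (uncurry₃ λ j n s → foldr (union-step n) s (downFrom j))
  unionBelow = prec-computable _ π₁
    (ifz-computable ∘ᶜ (bit-computable ∘ᶜ π₂ ∷ᶜ π₀ ∷ᶜ []ᶜ) ∷ᶜ π₁
      ∷ᶜ (insert-computable ∘ᶜ π₀ ∷ᶜ π₁ ∷ᶜ []ᶜ) ∷ᶜ []ᶜ)
    (λ _ → refl) (λ _ _ → refl)

∈-union-step⁺ : ∀ n i r y → y ∈D r → y ∈D union-step n i r
∈-union-step⁺ n i r y y∈r with bit n i
... | zero  = y∈r
... | suc _ = ∈-insert⁺ i r y y∈r

∈-union-step-self : ∀ n i r → i ∈D n → i ∈D union-step n i r
∈-union-step-self n i r i∈n with bit n i
... | zero  = contradiction i∈n 0≢1+n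
... | suc _ = ∈-insert-self i r

cardD-union-step : ∀ n i r → cardD (union-step n i r) ≤ cardD r + bit n i
cardD-union-step n i r with bit n i
... | zero  = m≤m+n (cardD r) 0
... | suc _ = ≤-trans (cardD-insert i r) (m<m+n (cardD r) (s≤s z≤n))

∈-union⁺ˡ : ∀ n s y → y ∈D s → y ∈D union n s
∈-union⁺ˡ n s y = foldr-downFrom-preserves (λ i r → ∈-union-step⁺ n i r y) n

∈-union⁺ʳ : ∀ n s y → y ∈D n → y ∈D union n s
∈-union⁺ʳ n s y y∈n = foldr-downFrom-establishes (λ i r → ∈-union-step⁺ n i r y) y
  (λ r → ∈-union-step-self n y r y∈n) n (∈D⇒< y∈n)

cardD-union : ∀ n s → cardD (union n s) ≤ cardD s + cardD n
cardD-union n s = foldr-downFrom-≤ cardD (bit n) (cardD-union-step n) n s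

bigUnion-step : ℕ → ℕ → ℕ → ℕ → ℕ
bigUnion-step s m n r = ifz (bit s n) r (ifz (cardD n ∸ m) (union n r) r)

-- D (bigUnion s m) = ⋃ { D n ∣ n ∈ D s, |D n| ≤ m }
bigUnion : ℕ → ℕ → ℕ
bigUnion s m = foldr (bigUnion-step s m) 0 (downFrom s)

bigUnion-computable : Computableⁿ 2 (uncurry₂ bigUnion)
bigUnion-computable = computable-≗ (bigUnionBelow ∘ᶜ π₀ ∷ᶜ π₀ ∷ᶜ π₁ ∷ᶜ []ᶜ) (λ _ → refl)
  where
  bigUnionBelow : Computableⁿ 3 (uncurry₃ λ j s m → foldr (bigUnion-step s m) 0 (downFrom j))
  bigUnionBelow = prec-computable _ (const-computable 0)
    (ifz-computable ∘ᶜ (bit-computable ∘ᶜ π₂ ∷ᶜ π₀ ∷ᶜ []ᶜ) ∷ᶜ π₁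
      ∷ᶜ (ifz-computable ∘ᶜ (∸-computable ∘ᶜ (cardD-computable ∘ᶜ π₀ ∷ᶜ []ᶜ) ∷ᶜ π₃ ∷ᶜ []ᶜ)
            ∷ᶜ (union-computable ∘ᶜ π₀ ∷ᶜ π₁ ∷ᶜ []ᶜ) ∷ᶜ π₁ ∷ᶜ []ᶜ)
      ∷ᶜ []ᶜ)
    (λ _ → refl) (λ _ _ → refl)

∈-bigUnion-step⁺ : ∀ s m n r y → y ∈D r → y ∈D bigUnion-step s m n r
∈-bigUnion-step⁺ s m n r y y∈r with bit s n | cardD n ∸ m
... | zero  | _     = y∈r
... | suc _ | zero  = ∈-union⁺ˡ n r y y∈r
... | suc _ | suc _ = y∈r

∈-bigUnion-step-self : ∀ s m n r y → n ∈D s → cardD n ≤ m → y ∈D n → y ∈D bigUnion-step s m n r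
∈-bigUnion-step-self s m n r y n∈s |n|≤m y∈n with bit s n
... | zero  = contradiction n∈s 0≢1+n
... | suc _ rewrite m≤n⇒m∸n≡0 |n|≤m = ∈-union⁺ʳ n r y y∈n

cardD-bigUnion-step : ∀ s m n r → cardD (bigUnion-step s m n r) ≤ cardD r + bit s n * m
cardD-bigUnion-step s m n r with bit s n | cardD n ∸ m in |n|∸m
... | zero  | _     = m≤m+n (cardD r) 0
... | suc k | zero  = ≤-trans (cardD-union n r)
                        (+-monoʳ-≤ (cardD r) (≤-trans (m∸n≡0⇒m≤n |n|∸m) (m≤m+n m (k * m))))
... | suc k | suc _ = m≤m+n (cardD r) (suc k * m)

∈-bigUnion : ∀ s m n y → n ∈D s → cardD n ≤ m → y ∈D n → y ∈D bigUnion s m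
∈-bigUnion s m n y n∈s |n|≤m y∈n = foldr-downFrom-establishes (λ i r → ∈-bigUnion-step⁺ s m i r y) n
  (λ r → ∈-bigUnion-step-self s m n r y n∈s |n|≤m y∈n) s (∈D⇒< n∈s)

cardD-bigUnion : ∀ s m → cardD (bigUnion s m) ≤ cardD s * m
cardD-bigUnion s m = ≤-trans (foldr-downFrom-≤ cardD (λ n → bit s n * m) (cardD-bigUnion-step s m) s 0)
  (≤-reflexive (sumBelow-*ʳ (bit s) m s))

computable-majorant : ∀ {a f} → CompTraceable a → f ≤T a →
  Σ (ℕ → ℕ) λ M → Computable M × (∀ m n → m ≤ n → M m ≤ M n) × (∀ k → f k < M k)
computable-majorant {f = f} (_ , _ , _ , trace) f≤a with trace f f≤a
... | T , T-computable , T-traces-f , _ = M , M-computable , M-mono , f<M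
  where
  M : ℕ → ℕ
  M k = sumBelow T (suc k)

  M-computable : Computable M
  M-computable = computableⁿ⇒computable
    (sumBelow-computable {λ i _ → T i} (computable⇒computableⁿ T-computable ∘ᶜ π₀ ∷ᶜ []ᶜ)
      ∘ᶜ (suc-computable ∘ᶜ π₀ ∷ᶜ []ᶜ) ∷ᶜ const-computable 0 ∷ᶜ []ᶜ)

  M-mono : ∀ m n → m ≤ n → M m ≤ M n
  M-mono m n m≤n = sumBelow-mono T (s≤s m≤n)

  f<M : ∀ k → f k < M k
  f<M k = ≤-trans (∈D⇒< (T-traces-f k)) (m≤n+m (T k) (sumBelow T k))

bigUnion-trace : ∀ {g t S M c} → Computable S → Computable M → Traces t g → Traces S t →
  (∀ k → cardD (t k) ≤ M k) → BoundedBy S c →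
  Σ (ℕ → ℕ) λ F → Computable F × Traces F g × BoundedBy F (λ k → c k * M k)
bigUnion-trace {g} {t} {S} {M} {c} S-computable M-computable t-traces-g S-traces-t t-bounded S-bounded =
  F , F-computable , F-traces-g , F-bounded
  where
  F : ℕ → ℕ
  F k = bigUnion (S k) (M k)

  F-computable : Computable F
  F-computable = computableⁿ⇒computable (bigUnion-computable
    ∘ᶜ computable⇒computableⁿ S-computable ∷ᶜ computable⇒computableⁿ M-computable ∷ᶜ []ᶜ)

  F-traces-g : Traces F g
  F-traces-g k = ∈-bigUnion (S k) (M k) (t k) (g k) (S-traces-t k) (t-bounded k) (t-traces-g k)

  F-bounded : BoundedBy F (λ k → c k * M k)
  F-bounded k = ≤-trans (cardD-bigUnion (S k) (M k)) (*-monoˡ-≤ (M k) (S-bounded k))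

compTraceableRel⇒compTraceable : ∀ {a b} → CompTraceable a → CompTraceableRel b a → CompTraceable b
compTraceableRel⇒compTraceable {b = b} a-traceable@(hA , hA-computable , (hA-mono , _) , traceA)
  (hB , hB≤a , (_ , hB-unbounded) , traceB) with computable-majorant a-traceable hB≤a
... | M , M-computable , M-mono , hB<M = h , h-computable , (h-mono , h-unbounded) , trace
  where
  h : ℕ → ℕ
  h k = suc (hA k) * M k

  M≤h : ∀ k → M k ≤ h k
  M≤h k = m≤m+n (M k) (hA k * M k)

  h-computable : Computable h
  h-computable = computableⁿ⇒computable (*-computable
    ∘ᶜ (suc-computable ∘ᶜ computable⇒computableⁿ hA-computable ∷ᶜ []ᶜ)
    ∷ᶜ computable⇒computableⁿ M-computable ∷ᶜ []ᶜ)

  h-mono : ∀ m n → m ≤ n → h m ≤ h n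
  h-mono m n m≤n = *-mono-≤ (s≤s (hA-mono m n m≤n)) (M-mono m n m≤n)

  h-unbounded : ∀ N → Σ ℕ λ k → N ≤ h k
  h-unbounded N with hB-unbounded N
  ... | k , N≤hB = k , ≤-trans N≤hB (≤-trans (<⇒≤ (hB<M k)) (M≤h k))

  trace : ∀ g → g ≤T b → Σ (ℕ → ℕ) λ F → Computable F × Traces F g × BoundedBy F h
  trace g g≤b with traceB g g≤b
  ... | t , t≤a , t-traces-g , t-bounded with traceA t t≤a
  ... | S , S-computable , S-traces-t , S-bounded
    with bigUnion-trace {g} {t} {S} {M} {hA} S-computable M-computable t-traces-g S-traces-t
           (λ k → ≤-trans (t-bounded k) (<⇒≤ (hB<M k))) S-bounded
  ... | F , F-computable , F-traces-g , F-bounded =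
    F , F-computable , F-traces-g , λ k → ≤-trans (F-bounded k) (m≤n+m (hA k * M k) (M k))

lemma6p8 : (A B : ℕ → Bool) →
    CompTraceable (χ A) → CompTraceableRel (χ B) (χ A) → CompTraceable (χ B)
lemma6p8 A B = compTraceableRel⇒compTraceable
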